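{- Let $\mathcal C$ be a category with a terminal object $1$ and limits of $\omega$-indexed chains, and let $(T,\mu,\eta)$ be a monad on $\mathcal C$. All pointwise extensions below are to $\mathrm{Sh}_{\mathcal C}(\omega)$. The following are equivalent: (1) $T$ is affine, i.e. $\eta_1\colon 1\to T1$ is an isomorphism; (2) for every endofunctor $F$ of $\mathcal C$ and every distributive law $\lambda\colon FT\to TF$ of the monad $T$ over $F$, there is a distributive law $\xi\colon\overline F\,{\blacktriangleright}\,\overline T\to\overline T\,\overline F\,{\blacktriangleright}$ of the monad $\overline T$ over $\overline F\circ{\blacktriangleright}$ which induces $\lambda$, i.e. $\lambda_X=\xi_{\Delta X,n+2}$ for all objects $X$ of $\mathcal C$ and all $n<\omega$.
   Context: $\mathrm{Sh}_{\mathcal C}(\omega)$: functors $X$ from $(\omega+1)^{op}$ (stages $0,1,2,\dots,\omega$) to $\mathcal C$, with restrictions $X_{\iota_{\beta,\beta'}}\colon X_{\beta'}\to X_\beta$ for $\beta\le\beta'$, such that $X_0\cong1$ and $X_\omega=\lim_{n<\omega}X_n$ via the restrictions; morphisms are natural transformations. $\Delta X$ is the constant sheaf ($X$ at stages $>0$, identities as restrictions between them, $1$ at stage $0$). Pointwise extension $\overline H$ of an endofunctor $H$: $(\overline HY)_0=1$, $(\overline HY)_{n+1}=H(Y_{n+1})$ with restrictions and morphisms acted on by $H$, $(\overline HY)_\omega=\lim_n H(Y_{n+1})$ with induced maps. $\overline T$ carries the monad structure given at successor stages by $\mu_{Y_{n+1}}$, $\eta_{Y_{n+1}}$ (and induced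 at limit stages). Later: $({\blacktriangleright}Y)_0=Y_0$, $({\blacktriangleright}Y)_{n+1}=Y_n$, $({\blacktriangleright}Y)_\omega=Y_\omega$, with induced restrictions. A distributive law of a monad $(S,\mu^S,\eta^S)$ over an endofunctor $H$ is a natural transformation $\lambda\colon HS\to SH$ with $\lambda\circ H\mu^S=\mu^S_H\circ S\lambda\circ\lambda_S$ and $\lambda\circ H\eta^S=\eta^S_H$. -}

module Defs where

open import Level using (Level; _⊔_) renaming (suc to lsuc)
open import Data.Nat using (ℕ; zero; suc; _≤_; z≤n; s≤s)
open import Data.Nat.Properties using (m≤n⇒m<n∨m≡n; ≤-pred)
open import Data.Sum using (inj₁; inj₂)
open import Data.Product using (Σ)
open import Relation.Binary using (Rel; IsEquivalence)
import Relation.Binary.PropositionalEquality as PE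

record Category (o ℓ e : Level) : Set (lsuc (o ⊔ ℓ ⊔ e)) where
  infix  4 _≈_ _⇒_
  infixr 9 _∘_
  field
    Obj       : Set o
    _⇒_       : Obj → Obj → Set ℓ
    _≈_       : ∀ {A B} → Rel (A ⇒ B) e
    id        : ∀ {A} → A ⇒ A
    _∘_       : ∀ {A B C} → B ⇒ C → A ⇒ B → A ⇒ C
    equiv     : ∀ {A B} → IsEquivalence (_≈_ {A} {B})
    assoc     : ∀ {A B C D} {f : A ⇒ B} {g : B ⇒ C} {h : C ⇒ D} →
                (h ∘ g) ∘ f ≈ h ∘ (g ∘ f)
    identityˡ : ∀ {A B} {f : A ⇒ B} → id ∘ f ≈ f
    identityʳ : ∀ {A B} {f : A ⇒ B} → f ∘ id ≈ f
    ∘-resp-≈  : ∀ {A B C} {f h : B ⇒ C} {g i : A ⇒ B} →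
                f ≈ h → g ≈ i → f ∘ g ≈ h ∘ i

  ≈-refl : ∀ {A B} {f : A ⇒ B} → f ≈ f
  ≈-refl = IsEquivalence.refl equiv
  ≈-sym : ∀ {A B} {f g : A ⇒ B} → f ≈ g → g ≈ f
  ≈-sym = IsEquivalence.sym equiv
  infixr 5 _○_
  _○_ : ∀ {A B} {f g h : A ⇒ B} → f ≈ g → g ≈ h → f ≈ h
  _○_ = IsEquivalence.trans equiv

module _ {o ℓ e} (C : Category o ℓ e) where
  open Category C

  record IsIso {A B : Obj} (f : A ⇒ B) : Set (ℓ ⊔ e) where
    field
      inv  : B ⇒ A
      isoˡ : inv ∘ f ≈ id
      isoʳ : f ∘ inv ≈ id

  record Iso (A B : Obj) : Set (ℓ ⊔ e) where
    field
      from  : A ⇒ B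
      isIso : IsIso from

  record Terminal : Set (o ⊔ ℓ ⊔ e) where
    field
      ⊤        : Obj
      !        : ∀ {A} → A ⇒ ⊤
      !-unique : ∀ {A} (f : A ⇒ ⊤) → ! ≈ f

  record Chain : Set (o ⊔ ℓ) where
    field
      D : ℕ → Obj
      d : ∀ n → D (suc n) ⇒ D n

  record Cone (K : Chain) : Set (o ⊔ ℓ ⊔ e) where
    open Chain K
    field
      apex    : Obj
      π       : ∀ n → apex ⇒ D n
      commute : ∀ n → d n ∘ π (suc n) ≈ π n

  record IsLimit (K : Chain) (c : Cone K) : Set (o ⊔ ℓ ⊔ e) where
    open Cone
    field
      mediate : (c' : Cone K) → apex c' ⇒ apex c
      factor  : (c' : Cone K) → ∀ n → π c n ∘ mediate c' ≈ π c' n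
      unique  : (c' : Cone K) (u : apex c' ⇒ apex c) →
                (∀ n → π c n ∘ u ≈ π c' n) → u ≈ mediate c'

  record Limit (K : Chain) : Set (o ⊔ ℓ ⊔ e) where
    field
      cone    : Cone K
      isLimit : IsLimit K cone

  ChainLimits : Set (o ⊔ ℓ ⊔ e)
  ChainLimits = (K : Chain) → Limit K

module _ {o ℓ e o′ ℓ′ e′} (C : Category o ℓ e) (D : Category o′ ℓ′ e′) where
  private
    module C = Category C
    module D = Category D

  record RawFunctor : Set (o ⊔ ℓ ⊔ o′ ⊔ ℓ′) where
    field
      F₀ : C.Obj → D.Obj
      F₁ : ∀ {A B} → A C.⇒ B → F₀ A D.⇒ F₀ B

  record Functor : Set (o ⊔ ℓ ⊔ e ⊔ o′ ⊔ ℓ′ ⊔ e′) where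
    field
      F₀           : C.Obj → D.Obj
      F₁           : ∀ {A B} → A C.⇒ B → F₀ A D.⇒ F₀ B
      identity     : ∀ {A} → F₁ (C.id {A}) D.≈ D.id
      homomorphism : ∀ {X Y Z} {f : X C.⇒ Y} {g : Y C.⇒ Z} →
                     F₁ (g C.∘ f) D.≈ F₁ g D.∘ F₁ f
      F-resp-≈     : ∀ {A B} {f g : A C.⇒ B} → f C.≈ g → F₁ f D.≈ F₁ g
    raw : RawFunctor
    raw = record { F₀ = F₀ ; F₁ = F₁ }

_∘R_ : ∀ {o ℓ e o′ ℓ′ e′ o″ ℓ″ e″}
         {C : Category o ℓ e} {D : Category o′ ℓ′ e′} {E : Category o″ ℓ″ e″} →
       RawFunctor D E → RawFunctor C D → RawFunctor C E
G ∘R F = record { F₀ = λ X → RawFunctor.F₀ G (RawFunctor.F₀ F X)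
                ; F₁ = λ f → RawFunctor.F₁ G (RawFunctor.F₁ F f) }

module _ {o ℓ e} (C : Category o ℓ e) where
  open Category C

  record RawMonad : Set (o ⊔ ℓ) where
    field
      T : RawFunctor C C
    open RawFunctor T
    field
      η : ∀ X → X ⇒ F₀ X
      μ : ∀ X → F₀ (F₀ X) ⇒ F₀ X

  record Monad : Set (o ⊔ ℓ ⊔ e) where
    field
      F : Functor C C
    open Functor F
    field
      η : ∀ X → X ⇒ F₀ X
      μ : ∀ X → F₀ (F₀ X) ⇒ F₀ X
      η-natural : ∀ {X Y} (f : X ⇒ Y) → η Y ∘ f ≈ F₁ f ∘ η X
      μ-natural : ∀ {X Y} (f : X ⇒ Y) → μ Y ∘ F₁ (F₁ f) ≈ F₁ f ∘ μ X
      μ-assoc   : ∀ {X} → μ X ∘ F₁ (μ X) ≈ μ X ∘ μ (F₀ X)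
      μ-unitˡ   : ∀ {X} → μ X ∘ F₁ (η X) ≈ id
      μ-unitʳ   : ∀ {X} → μ X ∘ η (F₀ X) ≈ id
    rawMonad : RawMonad
    rawMonad = record { T = Functor.raw F ; η = η ; μ = μ }

  record DistLaw (H : RawFunctor C C) (S : RawMonad) : Set (o ⊔ ℓ ⊔ e) where
    private
      module H = RawFunctor H
      module S = RawFunctor (RawMonad.T S)
    open RawMonad S using (η; μ)
    field
      law     : ∀ X → H.F₀ (S.F₀ X) ⇒ S.F₀ (H.F₀ X)
      natural : ∀ {X Y} (f : X ⇒ Y) → law Y ∘ H.F₁ (S.F₁ f) ≈ S.F₁ (H.F₁ f) ∘ law X
      mult    : ∀ X → law X ∘ H.F₁ (μ X) ≈ μ (H.F₀ X) ∘ (S.F₁ (law X) ∘ law (S.F₀ X))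
      unit    : ∀ X → law X ∘ H.F₁ (η X) ≈ η (H.F₀ X)

  Affine : Terminal C → Monad → Set (ℓ ⊔ e)
  Affine term M = IsIso C (Monad.η M (Terminal.⊤ term))

data Stage : Set where
  ⟨_⟩ : ℕ → Stage
  ω   : Stage

data _≤ₛ_ : Stage → Stage → Set where
  fin≤  : ∀ {m n} → m ≤ n → ⟨ m ⟩ ≤ₛ ⟨ n ⟩
  fin≤ω : ∀ {m} → ⟨ m ⟩ ≤ₛ ω
  ω≤ω   : ω ≤ₛ ω

n≤suc : ∀ n → n ≤ suc n
n≤suc zero    = z≤n
n≤suc (suc n) = s≤s (n≤suc n)

step : ∀ n → ⟨ n ⟩ ≤ₛ ⟨ suc n ⟩
step n = fin≤ (n≤suc n)

prev : Stage → Stage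
prev ⟨ zero ⟩  = ⟨ zero ⟩
prev ⟨ suc n ⟩ = ⟨ n ⟩
prev ω         = ω

prev-mono : ∀ {β β′} → β ≤ₛ β′ → prev β ≤ₛ prev β′
prev-mono {⟨ zero ⟩} {⟨ zero ⟩}  (fin≤ _) = fin≤ z≤n
prev-mono {⟨ zero ⟩} {⟨ suc n ⟩} (fin≤ _) = fin≤ z≤n
prev-mono {⟨ suc m ⟩} {⟨ suc n ⟩} (fin≤ (s≤s p)) = fin≤ p
prev-mono {⟨ zero ⟩}  fin≤ω = fin≤ω
prev-mono {⟨ suc m ⟩} fin≤ω = fin≤ω
prev-mono ω≤ω = ω≤ω

module ShDefs {o ℓ e} (C : Category o ℓ e) (term : Terminal C) (lims : ChainLimits C) where
  open Category C
  open Terminal term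

  !-unique₂ : ∀ {A} (f g : A ⇒ ⊤) → f ≈ g
  !-unique₂ f g = ≈-sym (!-unique f) ○ !-unique g

  -- functors (ω+1)^op → C
  record Presheaf : Set (o ⊔ ℓ ⊔ e) where
    field
      ob     : Stage → Obj
      res    : ∀ {β β′} → β ≤ₛ β′ → ob β′ ⇒ ob β
      res-id : ∀ {β} (p : β ≤ₛ β) → res p ≈ id
      res-∘  : ∀ {β β′ β″} (p : β ≤ₛ β′) (q : β′ ≤ₛ β″) (r : β ≤ₛ β″) →
               res r ≈ res p ∘ res q
  open Presheaf

  record PMor (P Q : Presheaf) : Set (ℓ ⊔ e) where
    field
      comp    : ∀ β → ob P β ⇒ ob Q β
      natural : ∀ {β β′} (p : β ≤ₛ β′) → res Q p ∘ comp β′ ≈ comp β ∘ res P p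
  open PMor

  chainOf : Presheaf → Chain C
  chainOf P = record { D = λ n → ob P ⟨ n ⟩ ; d = λ n → res P (step n) }

  coneOf : (P : Presheaf) → Cone C (chainOf P)
  coneOf P = record
    { apex = ob P ω
    ; π = λ n → res P fin≤ω
    ; commute = λ n → ≈-sym (res-∘ P (step n) fin≤ω fin≤ω) }

  record IsSheaf (P : Presheaf) : Set (o ⊔ ℓ ⊔ e) where
    field
      zero-iso : Iso C (ob P ⟨ zero ⟩) ⊤
      limit    : IsLimit C (chainOf P) (coneOf P)

  record Sheaf : Set (o ⊔ ℓ ⊔ e) where
    field
      psh     : Presheaf
      isSheaf : IsSheaf psh
  open Sheaf

  Sh : Category (o ⊔ ℓ ⊔ e) (ℓ ⊔ e) e
  Sh = record
    { Obj = Sheaf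
    ; _⇒_ = λ X Y → PMor (psh X) (psh Y)
    ; _≈_ = λ f g → ∀ β → comp f β ≈ comp g β
    ; id = record { comp = λ β → id ; natural = λ p → identityʳ ○ ≈-sym identityˡ }
    ; _∘_ = λ g f → record
        { comp = λ β → comp g β ∘ comp f β
        ; natural = λ p → ≈-sym assoc ○ ∘-resp-≈ (natural g p) ≈-refl ○ assoc
                          ○ ∘-resp-≈ ≈-refl (natural f p) ○ ≈-sym assoc }
    ; equiv = record
        { refl = λ β → ≈-refl
        ; sym = λ p β → ≈-sym (p β)
        ; trans = λ p q β → p β ○ q β }
    ; assoc = λ β → assoc
    ; identityˡ = λ β → identityˡ
    ; identityʳ = λ β → identityʳ
    ; ∘-resp-≈ = λ p q β → ∘-resp-≈ (p β) (q β)
    }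

  cone-trans : (K : Chain C) (c : Cone C K)
    (R : ∀ {m n} → m ≤ n → Chain.D K n ⇒ Chain.D K m)
    (R-id : ∀ {n} (p : n ≤ n) → R p ≈ id)
    (R-step : ∀ {m n} (p : m ≤ n) (q : m ≤ suc n) → R q ≈ R p ∘ Chain.d K n) →
    ∀ {m n} (p : m ≤ n) → Cone.π c m ≈ R p ∘ Cone.π c n
  cone-trans K c R R-id R-step {n = zero} z≤n =
    ≈-sym (∘-resp-≈ (R-id z≤n) ≈-refl ○ identityˡ)
  cone-trans K c R R-id R-step {m} {suc n} p with m≤n⇒m<n∨m≡n p
  ... | inj₂ PE.refl = ≈-sym (∘-resp-≈ (R-id p) ≈-refl ○ identityˡ)
  ... | inj₁ m<sn =
    let q = ≤-pred m<sn in
    cone-trans K c R R-id R-step q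
    ○ ∘-resp-≈ ≈-refl (≈-sym (Cone.commute c n))
    ○ ≈-sym assoc
    ○ ∘-resp-≈ (≈-sym (R-step q p)) ≈-refl

  module Over (H : Functor C C) where
    open Functor H

    hchain : Presheaf → Chain C
    hchain P = record
      { D = λ n → F₀ (ob P ⟨ suc n ⟩)
      ; d = λ n → F₁ (res P (fin≤ (s≤s (n≤suc n)))) }

    hlim : (P : Presheaf) → Limit C (hchain P)
    hlim P = lims (hchain P)

    hπ : (P : Presheaf) → ∀ n → Cone.apex (Limit.cone (hlim P)) ⇒ F₀ (ob P ⟨ suc n ⟩)
    hπ P = Cone.π (Limit.cone (hlim P))

    obH : Presheaf → Stage → Obj
    obH P ⟨ zero ⟩  = ⊤
    obH P ⟨ suc n ⟩ = F₀ (ob P ⟨ suc n ⟩)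
    obH P ω         = Cone.apex (Limit.cone (hlim P))

    resH : ∀ P {β β′} → β ≤ₛ β′ → obH P β′ ⇒ obH P β
    resH P {⟨ zero ⟩} _ = !
    resH P {⟨ suc m ⟩} {⟨ suc n ⟩} (fin≤ (s≤s p)) = F₁ (res P (fin≤ (s≤s p)))
    resH P {⟨ suc m ⟩} {ω} fin≤ω = hπ P m
    resH P {ω} {ω} ω≤ω = id

    resH-id : ∀ P {β} (p : β ≤ₛ β) → resH P p ≈ id
    resH-id P {⟨ zero ⟩} p = !-unique₂ _ _
    resH-id P {⟨ suc n ⟩} (fin≤ (s≤s p)) = F-resp-≈ (res-id P _) ○ identity
    resH-id P {ω} ω≤ω = ≈-refl

    hproj : ∀ P {m n} (p : m ≤ n) →
            hπ P m ≈ F₁ (res P (fin≤ (s≤s p))) ∘ hπ P n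
    hproj P = cone-trans (hchain P) (Limit.cone (hlim P))
      (λ p → F₁ (res P (fin≤ (s≤s p))))
      (λ p → F-resp-≈ (res-id P _) ○ identity)
      (λ p q → F-resp-≈ (res-∘ P _ _ _) ○ homomorphism)

    resH-∘ : ∀ P {β β′ β″} (p : β ≤ₛ β′) (q : β′ ≤ₛ β″) (r : β ≤ₛ β″) →
             resH P r ≈ resH P p ∘ resH P q
    resH-∘ P {⟨ zero ⟩} p q r = !-unique₂ _ _
    resH-∘ P {⟨ suc m ⟩} {⟨ suc n ⟩} {⟨ suc k ⟩} (fin≤ (s≤s p)) (fin≤ (s≤s q)) (fin≤ (s≤s r)) =
      F-resp-≈ (res-∘ P _ _ _) ○ homomorphism
    resH-∘ P {⟨ suc m ⟩} {⟨ suc n ⟩} {ω} (fin≤ (s≤s p)) fin≤ω fin≤ω = hproj P p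
    resH-∘ P {⟨ suc m ⟩} {ω} {ω} fin≤ω ω≤ω fin≤ω = ≈-sym identityʳ
    resH-∘ P {ω} {ω} {ω} ω≤ω ω≤ω ω≤ω = ≈-sym identityˡ

    bar : Presheaf → Presheaf
    bar P = record { ob = obH P ; res = resH P ; res-id = resH-id P ; res-∘ = resH-∘ P }

    barSheaf : (P : Presheaf) → IsSheaf (bar P)
    barSheaf P = record
      { zero-iso = record { from = id ; isIso = record { inv = id ; isoˡ = identityˡ ; isoʳ = identityˡ } }
      ; limit = record
          { mediate = λ c′ → IsLimit.mediate L (shift c′)
          ; factor = fac
          ; unique = λ c′ u h → IsLimit.unique L (shift c′) u (λ n → h (suc n)) } }
      where
        L = Limit.isLimit (hlim P)
        shift : Cone C (chainOf (bar P)) → Cone C (hchain P)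
        shift c′ = record
          { apex = Cone.apex c′
          ; π = λ n → Cone.π c′ (suc n)
          ; commute = λ n → Cone.commute c′ (suc n) }
        fac : (c′ : Cone C (chainOf (bar P))) → ∀ n →
              Cone.π (coneOf (bar P)) n ∘ IsLimit.mediate L (shift c′) ≈ Cone.π c′ n
        fac c′ zero = !-unique₂ _ _
        fac c′ (suc n) = IsLimit.factor L (shift c′) n

    mapCone : ∀ {P Q} → PMor P Q → Cone C (hchain Q)
    mapCone {P} {Q} f = record
      { apex = Cone.apex (Limit.cone (hlim P))
      ; π = λ n → F₁ (comp f ⟨ suc n ⟩) ∘ hπ P n
      ; commute = λ n →
          ≈-sym assoc
          ○ ∘-resp-≈ (≈-sym homomorphism ○ F-resp-≈ (natural f _) ○ homomorphism) ≈-refl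
          ○ assoc
          ○ ∘-resp-≈ ≈-refl (Cone.commute (Limit.cone (hlim P)) n) }

    compH : ∀ {P Q} → PMor P Q → ∀ β → obH P β ⇒ obH Q β
    compH f ⟨ zero ⟩  = id
    compH f ⟨ suc n ⟩ = F₁ (comp f ⟨ suc n ⟩)
    compH {Q = Q} f ω = IsLimit.mediate (Limit.isLimit (hlim Q)) (mapCone f)

    natH : ∀ {P Q} (f : PMor P Q) {β β′} (p : β ≤ₛ β′) →
           resH Q p ∘ compH f β′ ≈ compH f β ∘ resH P p
    natH f {⟨ zero ⟩} p = !-unique₂ _ _
    natH f {⟨ suc m ⟩} {⟨ suc n ⟩} (fin≤ (s≤s p)) =
      ≈-sym homomorphism ○ F-resp-≈ (natural f _) ○ homomorphism
    natH {Q = Q} f {⟨ suc m ⟩} {ω} fin≤ω = IsLimit.factor (Limit.isLimit (hlim Q)) (mapCone f) m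
    natH f {ω} {ω} ω≤ω = identityˡ ○ ≈-sym identityʳ

    barMor : ∀ {P Q} → PMor P Q → PMor (bar P) (bar Q)
    barMor f = record { comp = compH f ; natural = natH f }

    barFunctor : RawFunctor Sh Sh
    barFunctor = record
      { F₀ = λ X → record { psh = bar (psh X) ; isSheaf = barSheaf (psh X) }
      ; F₁ = barMor }

  later : Presheaf → Presheaf
  later P = record
    { ob = λ β → ob P (prev β)
    ; res = λ p → res P (prev-mono p)
    ; res-id = λ p → res-id P _
    ; res-∘ = λ p q r → res-∘ P _ _ _ }

  laterMor : ∀ {P Q} → PMor P Q → PMor (later P) (later Q)
  laterMor f = record { comp = λ β → comp f (prev β) ; natural = λ p → natural f (prev-mono p) }

  laterSheaf : (P : Presheaf) → IsSheaf P → IsSheaf (later P)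
  laterSheaf P s = record
    { zero-iso = IsSheaf.zero-iso s
    ; limit = record
        { mediate = λ c′ → IsLimit.mediate L (shift c′)
        ; factor = fac
        ; unique = λ c′ u h → IsLimit.unique L (shift c′) u (λ n → h (suc n)) } }
    where
      L = IsSheaf.limit s
      shift : Cone C (chainOf (later P)) → Cone C (chainOf P)
      shift c′ = record
        { apex = Cone.apex c′
        ; π = λ n → Cone.π c′ (suc n)
        ; commute = λ n → Cone.commute c′ (suc n) }
      fac : (c′ : Cone C (chainOf (later P))) → ∀ n →
            Cone.π (coneOf (later P)) n ∘ IsLimit.mediate L (shift c′) ≈ Cone.π c′ n
      fac c′ zero = IsLimit.factor L (shift c′) zero
        ○ ≈-sym identityˡ
        ○ ∘-resp-≈ (≈-sym (res-id P _)) ≈-refl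
        ○ Cone.commute c′ zero
      fac c′ (suc n) = IsLimit.factor L (shift c′) n

  laterFunctor : RawFunctor Sh Sh
  laterFunctor = record
    { F₀ = λ X → record { psh = later (psh X) ; isSheaf = laterSheaf (psh X) (isSheaf X) }
    ; F₁ = laterMor }

  obΔ : Obj → Stage → Obj
  obΔ X ⟨ zero ⟩  = ⊤
  obΔ X ⟨ suc _ ⟩ = X
  obΔ X ω         = X

  resΔ : ∀ X {β β′} → β ≤ₛ β′ → obΔ X β′ ⇒ obΔ X β
  resΔ X {⟨ zero ⟩} _ = !
  resΔ X {⟨ suc _ ⟩} {⟨ suc _ ⟩} (fin≤ _) = id
  resΔ X {⟨ suc _ ⟩} {ω} fin≤ω = id
  resΔ X {ω} {ω} ω≤ω = id

  resΔ-id : ∀ X {β} (p : β ≤ₛ β) → resΔ X p ≈ id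
  resΔ-id X {⟨ zero ⟩} p = !-unique₂ _ _
  resΔ-id X {⟨ suc _ ⟩} (fin≤ _) = ≈-refl
  resΔ-id X {ω} ω≤ω = ≈-refl

  resΔ-∘ : ∀ X {β β′ β″} (p : β ≤ₛ β′) (q : β′ ≤ₛ β″) (r : β ≤ₛ β″) →
           resΔ X r ≈ resΔ X p ∘ resΔ X q
  resΔ-∘ X {⟨ zero ⟩} p q r = !-unique₂ _ _
  resΔ-∘ X {⟨ suc _ ⟩} {⟨ suc _ ⟩} {⟨ suc _ ⟩} (fin≤ (s≤s _)) (fin≤ (s≤s _)) (fin≤ _) = ≈-sym identityˡ
  resΔ-∘ X {⟨ suc _ ⟩} {⟨ suc _ ⟩} {ω} (fin≤ (s≤s _)) fin≤ω fin≤ω = ≈-sym identityˡ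
  resΔ-∘ X {⟨ suc _ ⟩} {ω} {ω} fin≤ω ω≤ω fin≤ω = ≈-sym identityˡ
  resΔ-∘ X {ω} {ω} {ω} ω≤ω ω≤ω ω≤ω = ≈-sym identityˡ

  ΔP : Obj → Presheaf
  ΔP X = record { ob = obΔ X ; res = resΔ X ; res-id = resΔ-id X ; res-∘ = resΔ-∘ X }

  ΔSheaf : (X : Obj) → IsSheaf (ΔP X)
  ΔSheaf X = record
    { zero-iso = record { from = id ; isIso = record { inv = id ; isoˡ = identityˡ ; isoʳ = identityˡ } }
    ; limit = record
        { mediate = λ c′ → Cone.π c′ 1
        ; factor = fac
        ; unique = λ c′ u h → ≈-sym identityˡ ○ h 1 } }
    where
      const : (c′ : Cone C (chainOf (ΔP X))) → ∀ n → Cone.π c′ 1 ≈ Cone.π c′ (suc n)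
      const c′ zero = ≈-refl
      const c′ (suc n) = const c′ n ○ ≈-sym (Cone.commute c′ (suc n)) ○ identityˡ
      fac : (c′ : Cone C (chainOf (ΔP X))) → ∀ n →
            Cone.π (coneOf (ΔP X)) n ∘ Cone.π c′ 1 ≈ Cone.π c′ n
      fac c′ zero = !-unique₂ _ _
      fac c′ (suc n) = identityˡ ○ const c′ n

  Δ : Obj → Sheaf
  Δ X = record { psh = ΔP X ; isSheaf = ΔSheaf X }

  module OverMonad (M : Monad C) where
    open Monad M
    open Functor F
    open Over F

    ηcone : (P : Presheaf) → Cone C (hchain P)
    ηcone P = record
      { apex = ob P ω
      ; π = λ n → η (ob P ⟨ suc n ⟩) ∘ res P fin≤ω
      ; commute = λ n →
          ≈-sym assoc
          ○ ∘-resp-≈ (≈-sym (η-natural _)) ≈-refl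
          ○ assoc
          ○ ∘-resp-≈ ≈-refl (≈-sym (res-∘ P _ fin≤ω fin≤ω)) }

    compη : (P : Presheaf) → ∀ β → ob P β ⇒ obH P β
    compη P ⟨ zero ⟩  = !
    compη P ⟨ suc n ⟩ = η (ob P ⟨ suc n ⟩)
    compη P ω         = IsLimit.mediate (Limit.isLimit (hlim P)) (ηcone P)

    natη : ∀ P {β β′} (p : β ≤ₛ β′) → resH P p ∘ compη P β′ ≈ compη P β ∘ res P p
    natη P {⟨ zero ⟩} p = !-unique₂ _ _
    natη P {⟨ suc m ⟩} {⟨ suc n ⟩} (fin≤ (s≤s p)) = ≈-sym (η-natural _)
    natη P {⟨ suc m ⟩} {ω} fin≤ω = IsLimit.factor (Limit.isLimit (hlim P)) (ηcone P) m
    natη P {ω} {ω} ω≤ω = identityˡ ○ ≈-sym identityʳ ○ ∘-resp-≈ ≈-refl (≈-sym (res-id P ω≤ω))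

    ηbar : (P : Presheaf) → PMor P (bar P)
    ηbar P = record { comp = compη P ; natural = natη P }

    μcone : (P : Presheaf) → Cone C (hchain P)
    μcone P = record
      { apex = Cone.apex (Limit.cone (hlim (bar P)))
      ; π = λ n → μ (ob P ⟨ suc n ⟩) ∘ hπ (bar P) n
      ; commute = λ n →
          ≈-sym assoc
          ○ ∘-resp-≈ (≈-sym (μ-natural _)) ≈-refl
          ○ assoc
          ○ ∘-resp-≈ ≈-refl (Cone.commute (Limit.cone (hlim (bar P))) n) }

    compμ : (P : Presheaf) → ∀ β → obH (bar P) β ⇒ obH P β
    compμ P ⟨ zero ⟩  = id
    compμ P ⟨ suc n ⟩ = μ (ob P ⟨ suc n ⟩)
    compμ P ω         = IsLimit.mediate (Limit.isLimit (hlim P)) (μcone P)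

    natμ : ∀ P {β β′} (p : β ≤ₛ β′) → resH P p ∘ compμ P β′ ≈ compμ P β ∘ resH (bar P) p
    natμ P {⟨ zero ⟩} p = !-unique₂ _ _
    natμ P {⟨ suc m ⟩} {⟨ suc n ⟩} (fin≤ (s≤s p)) = ≈-sym (μ-natural _)
    natμ P {⟨ suc m ⟩} {ω} fin≤ω = IsLimit.factor (Limit.isLimit (hlim P)) (μcone P) m
    natμ P {ω} {ω} ω≤ω = identityˡ ○ ≈-sym identityʳ

    μbar : (P : Presheaf) → PMor (bar (bar P)) (bar P)
    μbar P = record { comp = compμ P ; natural = natμ P }

    barMonad : RawMonad Sh
    barMonad = record
      { T = barFunctor
      ; η = λ X → ηbar (psh X)
      ; μ = λ X → μbar (psh X) }

module _ {o ℓ e} (C : Category o ℓ e) (term : Terminal C) (lims : ChainLimits C) (M : Monad C) where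
  open Category C
  open ShDefs C term lims

  Induces : (F : Functor C C) → DistLaw C (Functor.raw F) (Monad.rawMonad M) →
            DistLaw Sh (Over.barFunctor F ∘R laterFunctor) (OverMonad.barMonad M) →
            Set (o ⊔ e)
  Induces F λc ξ = ∀ (X : Obj) (n : ℕ) →
    DistLaw.law λc X ≈ PMor.comp (DistLaw.law ξ (Δ X)) ⟨ suc (suc n) ⟩

  Condition2 : Set (o ⊔ ℓ ⊔ e)
  Condition2 = (F : Functor C C) (λc : DistLaw C (Functor.raw F) (Monad.rawMonad M)) →
    Σ (DistLaw Sh (Over.barFunctor F ∘R laterFunctor) (OverMonad.barMonad M)) (Induces F λc)

{-# OPTIONS --safe #-}
-- For affine T, ξ is the composite  F̄▸T̄ → F̄T̄▸ → T̄F̄▸  of F̄κ, for a distributive law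
-- κ : ▸T̄ → T̄▸, with the pointwise extension λ̄ of λ.  At stage n + 2, κ is the identity
-- of T Y_{n+1}; at stage 1 it is a map 1 → T Y₀, and its equations hold there because
-- an affine T sends objects ≅ 1 to subterminal objects.  Equations between morphisms
-- of sheaves need only be checked at successor stages: stage 0 is ≅ 1 and stage ω is
-- a limit.  Conversely, for F = Id and λ = id, the unit law of ξ at Δ1 and stage 1
-- gives η₁ = ξ₁ ∘ !, while naturality of ξ between stages 1 and 2 gives
-- ξ₁ ∘ ! = T! ∘ ξ₂ = id, so ! is inverse to η₁.
module Submission where

open import Level using (_⊔_)
open import Data.Nat using (zero; suc; _≤_; s≤s)
open import Data.Product using (_,_)
open import Function.Bundles using (_⇔_; mk⇔)
open import Relation.Binary using (Setoid)
import Relation.Binary.Reasoning.Setoid as SetoidReasoning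
open import Defs

module HomReasoning {o ℓ e} (C : Category o ℓ e) where
  open Category C

  hom-setoid : (A B : Obj) → Setoid ℓ e
  hom-setoid A B = record { Carrier = A ⇒ B ; _≈_ = _≈_ ; isEquivalence = equiv }

  module _ {A B : Obj} where
    open SetoidReasoning (hom-setoid A B) public

  infixr 6 _⟩∘⟨_
  _⟩∘⟨_ : ∀ {A B D} {f h : B ⇒ D} {g i : A ⇒ B} → f ≈ h → g ≈ i → f ∘ g ≈ h ∘ i
  _⟩∘⟨_ = ∘-resp-≈

module _ {o ℓ e} (C : Category o ℓ e) where
  open Category C
  open HomReasoning C

  Subterminal : Obj → Set (o ⊔ ℓ ⊔ e)
  Subterminal X = ∀ {A} (f g : A ⇒ X) → f ≈ g

  retract-subterminal : ∀ {X Y} (s : X ⇒ Y) (r : Y ⇒ X) → r ∘ s ≈ id →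
                        Subterminal Y → Subterminal X
  retract-subterminal s r r∘s≈id Y-sub f g = begin
    f             ≈⟨ through f ⟩
    r ∘ (s ∘ f)   ≈⟨ ≈-refl ⟩∘⟨ Y-sub (s ∘ f) (s ∘ g) ⟩
    r ∘ (s ∘ g)   ≈⟨ ≈-sym (through g) ⟩
    g             ∎
    where
      through : ∀ {A} (h : A ⇒ _) → h ≈ r ∘ (s ∘ h)
      through h = ≈-sym identityˡ ○ (≈-sym r∘s≈id ⟩∘⟨ ≈-refl) ○ assoc

  projections-jointly-monic : ∀ {K : Chain C} {c : Cone C K} → IsLimit C K c →
    ∀ {A} (f g : A ⇒ Cone.apex c) → (∀ n → Cone.π c n ∘ f ≈ Cone.π c n ∘ g) → f ≈ g
  projections-jointly-monic {K} {c} L {A} f g πf≈πg =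
    IsLimit.unique L through-g f πf≈πg ○ ≈-sym (IsLimit.unique L through-g g (λ n → ≈-refl))
    where
      through-g : Cone C K
      through-g = record
        { apex = A
        ; π = λ n → Cone.π c n ∘ g
        ; commute = λ n → ≈-sym assoc ○ (Cone.commute c n ⟩∘⟨ ≈-refl) }

  idFunctor : Functor C C
  idFunctor = record
    { F₀ = λ X → X ; F₁ = λ f → f
    ; identity = ≈-refl ; homomorphism = ≈-refl ; F-resp-≈ = λ f≈g → f≈g }

  idDistLaw : (M : Monad C) → DistLaw C (Functor.raw idFunctor) (Monad.rawMonad M)
  idDistLaw M = record
    { law = λ X → id
    ; natural = λ f → identityˡ ○ ≈-sym identityʳ
    ; mult = λ X → identityˡ ○ ≈-sym ((≈-refl ⟩∘⟨ (identityʳ ○ identity)) ○ identityʳ)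
    ; unit = λ X → identityˡ }
    where open Functor (Monad.F M)

module _ {o ℓ e} {C : Category o ℓ e} (term : Terminal C) where
  open Category C
  open Terminal term

  ⊤-subterminal : Subterminal C ⊤
  ⊤-subterminal f g = ≈-sym (!-unique f) ○ !-unique g

  iso-⊤⇒subterminal : ∀ {Z} → Iso C Z ⊤ → Subterminal C Z
  iso-⊤⇒subterminal i =
    retract-subterminal C (Iso.from i) (IsIso.inv (Iso.isIso i)) (IsIso.isoˡ (Iso.isIso i))
      ⊤-subterminal

  affine⇒T-subterminal : (M : Monad C) → Affine C term M →
    ∀ {Z} → Iso C Z ⊤ → Subterminal C (Functor.F₀ (Monad.F M) Z)
  affine⇒T-subterminal M aff i =
    retract-subterminal C (T.F₁ (Iso.from i)) (T.F₁ (IsIso.inv (Iso.isIso i)))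
      (≈-sym T.homomorphism ○ T.F-resp-≈ (IsIso.isoˡ (Iso.isIso i)) ○ T.identity)
      (retract-subterminal C (IsIso.inv aff) (Monad.η M ⊤) (IsIso.isoʳ aff) ⊤-subterminal)
    where module T = Functor (Monad.F M)

module _ {o ℓ e} {C : Category o ℓ e} (H : Functor C C) (K : RawFunctor C C) (S : RawMonad C) where
  open Category C
  open HomReasoning C
  private
    module H = Functor H
    module K = RawFunctor K
    module S = RawFunctor (RawMonad.T S)
  open RawMonad S using (η; μ)

  distLaw-∘ : (∀ {X Y Z} {f : X ⇒ Y} {g : Y ⇒ Z} → S.F₁ (g ∘ f) ≈ S.F₁ g ∘ S.F₁ f) →
              DistLaw C H.raw S → DistLaw C K S → DistLaw C (H.raw ∘R K) S
  distLaw-∘ S-homomorphism α β = record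
    { law = γ
    ; natural = natural
    ; mult = mult
    ; unit = unit }
    where
      module α = DistLaw α
      module β = DistLaw β

      γ : ∀ X → H.F₀ (K.F₀ (S.F₀ X)) ⇒ S.F₀ (H.F₀ (K.F₀ X))
      γ X = α.law (K.F₀ X) ∘ H.F₁ (β.law X)

      H-square : ∀ {A B B′ D} {a : B ⇒ D} {b : A ⇒ B} {c : B′ ⇒ D} {d : A ⇒ B′} →
                 a ∘ b ≈ c ∘ d → H.F₁ a ∘ H.F₁ b ≈ H.F₁ c ∘ H.F₁ d
      H-square a∘b≈c∘d = ≈-sym H.homomorphism ○ H.F-resp-≈ a∘b≈c∘d ○ H.homomorphism

      natural : ∀ {X Y} (f : X ⇒ Y) →
                γ Y ∘ H.F₁ (K.F₁ (S.F₁ f)) ≈ S.F₁ (H.F₁ (K.F₁ f)) ∘ γ X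
      natural {X} {Y} f = begin
        (α.law (K.F₀ Y) ∘ H.F₁ (β.law Y)) ∘ H.F₁ (K.F₁ (S.F₁ f))
          ≈⟨ assoc ○ (≈-refl ⟩∘⟨ H-square (β.natural f)) ⟩
        α.law (K.F₀ Y) ∘ (H.F₁ (S.F₁ (K.F₁ f)) ∘ H.F₁ (β.law X))
          ≈⟨ ≈-sym assoc ○ (α.natural (K.F₁ f) ⟩∘⟨ ≈-refl) ○ assoc ⟩
        S.F₁ (H.F₁ (K.F₁ f)) ∘ γ X ∎

      unit : ∀ X → γ X ∘ H.F₁ (K.F₁ (η X)) ≈ η (H.F₀ (K.F₀ X))
      unit X = begin
        (α.law (K.F₀ X) ∘ H.F₁ (β.law X)) ∘ H.F₁ (K.F₁ (η X))
          ≈⟨ assoc ○ (≈-refl ⟩∘⟨ (≈-sym H.homomorphism ○ H.F-resp-≈ (β.unit X))) ⟩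
        α.law (K.F₀ X) ∘ H.F₁ (η (K.F₀ X))
          ≈⟨ α.unit (K.F₀ X) ⟩
        η (H.F₀ (K.F₀ X)) ∎

      mult : ∀ X → γ X ∘ H.F₁ (K.F₁ (μ X)) ≈ μ (H.F₀ (K.F₀ X)) ∘ (S.F₁ (γ X) ∘ γ (S.F₀ X))
      mult X = begin
        (αK ∘ H.F₁ (β.law X)) ∘ H.F₁ (K.F₁ (μ X))
          ≈⟨ assoc ○ (≈-refl ⟩∘⟨ (≈-sym H.homomorphism ○ H.F-resp-≈ (β.mult X))) ⟩
        αK ∘ H.F₁ (μ (K.F₀ X) ∘ (S.F₁ (β.law X) ∘ β.law (S.F₀ X)))
          ≈⟨ ≈-refl ⟩∘⟨ (H.homomorphism ○ (≈-refl ⟩∘⟨ H.homomorphism)) ⟩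
        αK ∘ (H.F₁ (μ (K.F₀ X)) ∘ (H.F₁ (S.F₁ (β.law X)) ∘ Hβ-S))
          ≈⟨ ≈-sym assoc ○ (α.mult (K.F₀ X) ⟩∘⟨ ≈-refl) ○ assoc ○ (≈-refl ⟩∘⟨ assoc) ⟩
        μ _ ∘ (S.F₁ αK ∘ (α.law (S.F₀ (K.F₀ X)) ∘ (H.F₁ (S.F₁ (β.law X)) ∘ Hβ-S)))
          ≈⟨ ≈-refl ⟩∘⟨ ≈-refl ⟩∘⟨ (≈-sym assoc ○ (α.natural (β.law X) ⟩∘⟨ ≈-refl) ○ assoc) ⟩
        μ _ ∘ (S.F₁ αK ∘ (S.F₁ (H.F₁ (β.law X)) ∘ γ (S.F₀ X)))
          ≈⟨ ≈-refl ⟩∘⟨ (≈-sym assoc ○ (≈-sym S-homomorphism ⟩∘⟨ ≈-refl)) ⟩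
        μ _ ∘ (S.F₁ (γ X) ∘ γ (S.F₀ X)) ∎
        where
          αK : H.F₀ (S.F₀ (K.F₀ X)) ⇒ S.F₀ (H.F₀ (K.F₀ X))
          αK = α.law (K.F₀ X)
          Hβ-S : H.F₀ (K.F₀ (S.F₀ (S.F₀ X))) ⇒ H.F₀ (S.F₀ (K.F₀ (S.F₀ X)))
          Hβ-S = H.F₁ (β.law (S.F₀ X))

module _ {o ℓ e} (C : Category o ℓ e) (term : Terminal C) (lims : ChainLimits C) where
  open Category C
  open Terminal term
  open HomReasoning C
  open ShDefs C term lims
  open Presheaf
  open PMor
  open Sheaf

  ob₀-subterminal : (Q : Sheaf) → Subterminal C (ob (psh Q) ⟨ 0 ⟩)
  ob₀-subterminal Q = iso-⊤⇒subterminal term (IsSheaf.zero-iso (isSheaf Q))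

  ≈-fromSuccessors : {P : Presheaf} (Q : Sheaf) (f g : PMor P (psh Q)) →
    (∀ n → comp f ⟨ suc n ⟩ ≈ comp g ⟨ suc n ⟩) → ∀ β → comp f β ≈ comp g β
  ≈-fromSuccessors Q f g f≈g = at
    where
      at-finite : ∀ n → comp f ⟨ n ⟩ ≈ comp g ⟨ n ⟩
      at-finite zero = ob₀-subterminal Q _ _
      at-finite (suc n) = f≈g n

      at : ∀ β → comp f β ≈ comp g β
      at ⟨ n ⟩ = at-finite n
      at ω = projections-jointly-monic C (IsSheaf.limit (isSheaf Q)) (comp f ω) (comp g ω)
        (λ n → natural f fin≤ω ○ (at-finite n ⟩∘⟨ ≈-refl) ○ ≈-sym (natural g fin≤ω))

  fromSuccessors : (P : Presheaf) (Q : Sheaf) (c : ∀ n → ob P ⟨ suc n ⟩ ⇒ ob (psh Q) ⟨ suc n ⟩) →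
    (∀ {m n} (p : m ≤ n) → res (psh Q) (fin≤ (s≤s p)) ∘ c n ≈ c m ∘ res P (fin≤ (s≤s p))) →
    PMor P (psh Q)
  fromSuccessors P Q c c-natural = record { comp = comp′ ; natural = natural′ }
    where
      L : IsLimit C (chainOf (psh Q)) (coneOf (psh Q))
      L = IsSheaf.limit (isSheaf Q)

      comp-finite : ∀ n → ob P ⟨ n ⟩ ⇒ ob (psh Q) ⟨ n ⟩
      comp-finite zero = IsIso.inv (Iso.isIso (IsSheaf.zero-iso (isSheaf Q))) ∘ !
      comp-finite (suc n) = c n

      natural-finite : ∀ {m n} (p : m ≤ n) →
        res (psh Q) (fin≤ p) ∘ comp-finite n ≈ comp-finite m ∘ res P (fin≤ p)
      natural-finite {zero} p = ob₀-subterminal Q _ _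
      natural-finite (s≤s p) = c-natural p

      cone : Cone C (chainOf (psh Q))
      cone = record
        { apex = ob P ω
        ; π = λ n → comp-finite n ∘ res P fin≤ω
        ; commute = λ n → ≈-sym assoc ○ (natural-finite (n≤suc n) ⟩∘⟨ ≈-refl) ○ assoc
                          ○ (≈-refl ⟩∘⟨ ≈-sym (res-∘ P (step n) fin≤ω fin≤ω)) }

      comp′ : ∀ β → ob P β ⇒ ob (psh Q) β
      comp′ ⟨ n ⟩ = comp-finite n
      comp′ ω = IsLimit.mediate L cone

      natural′ : ∀ {β β′} (p : β ≤ₛ β′) → res (psh Q) p ∘ comp′ β′ ≈ comp′ β ∘ res P p
      natural′ (fin≤ p) = natural-finite p
      natural′ (fin≤ω {m}) = IsLimit.factor L cone m
      natural′ ω≤ω = (res-id (psh Q) ω≤ω ⟩∘⟨ ≈-refl) ○ identityˡ ○ ≈-sym identityʳ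
                     ○ (≈-refl ⟩∘⟨ ≈-sym (res-id P ω≤ω))

  -- Morphisms of Sh only mention the underlying presheaves, so Agda cannot infer the
  -- sheaves in Sh's implicit object arguments; they are supplied by hand below.
  barEndofunctor : Functor C C → Functor Sh Sh
  barEndofunctor F = record
    { F₀ = F̄.F₀
    ; F₁ = λ {A} {B} → F̄.F₁ {A} {B}
    ; identity = λ {X} →
        ≈-fromSuccessors (F̄.F₀ X) (F̄.F₁ {X} {X} (Sh.id {X})) (Sh.id {F̄.F₀ X}) (λ n → F.identity)
    ; homomorphism = λ {X} {Y} {Z} {f} {g} →
        ≈-fromSuccessors (F̄.F₀ Z) (F̄.F₁ {X} {Z} (Sh._∘_ {X} {Y} {Z} g f))
          (Sh._∘_ {F̄.F₀ X} {F̄.F₀ Y} {F̄.F₀ Z} (F̄.F₁ {Y} {Z} g) (F̄.F₁ {X} {Y} f))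
          (λ n → F.homomorphism)
    ; F-resp-≈ = λ {A} {B} {f} {g} f≈g →
        ≈-fromSuccessors (F̄.F₀ B) (F̄.F₁ {A} {B} f) (F̄.F₁ {A} {B} g)
          (λ n → F.F-resp-≈ (f≈g ⟨ suc n ⟩)) }
    where
      module F = Functor F
      module F̄ = RawFunctor (Over.barFunctor F)
      module Sh = Category Sh

  module _ (H : RawFunctor Sh Sh) (S : RawMonad Sh) where
    private
      module H = RawFunctor H
      module S = RawFunctor (RawMonad.T S)
      module Sh = Category Sh
      open RawMonad S using () renaming (η to η̂; μ to μ̂)

    distLaw-fromSuccessors : (law : ∀ Y → H.F₀ (S.F₀ Y) Sh.⇒ S.F₀ (H.F₀ Y)) →
      (∀ {Y Y′} (f : Y Sh.⇒ Y′) n →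
         comp (law Y′) ⟨ suc n ⟩ ∘ comp (H.F₁ {S.F₀ Y} {S.F₀ Y′} (S.F₁ {Y} {Y′} f)) ⟨ suc n ⟩
           ≈ comp (S.F₁ {H.F₀ Y} {H.F₀ Y′} (H.F₁ {Y} {Y′} f)) ⟨ suc n ⟩ ∘ comp (law Y) ⟨ suc n ⟩) →
      (∀ Y n →
         comp (law Y) ⟨ suc n ⟩ ∘ comp (H.F₁ {S.F₀ (S.F₀ Y)} {S.F₀ Y} (μ̂ Y)) ⟨ suc n ⟩
           ≈ comp (μ̂ (H.F₀ Y)) ⟨ suc n ⟩
             ∘ (comp (S.F₁ {H.F₀ (S.F₀ Y)} {S.F₀ (H.F₀ Y)} (law Y)) ⟨ suc n ⟩
                ∘ comp (law (S.F₀ Y)) ⟨ suc n ⟩)) →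
      (∀ Y n →
         comp (law Y) ⟨ suc n ⟩ ∘ comp (H.F₁ {Y} {S.F₀ Y} (η̂ Y)) ⟨ suc n ⟩
           ≈ comp (η̂ (H.F₀ Y)) ⟨ suc n ⟩) →
      DistLaw Sh H S
    distLaw-fromSuccessors law law-natural law-mult law-unit = record
      { law = law
      ; natural = λ {Y} {Y′} f → ≈-fromSuccessors (S.F₀ (H.F₀ Y′))
          (Sh._∘_ {H.F₀ (S.F₀ Y)} {H.F₀ (S.F₀ Y′)} {S.F₀ (H.F₀ Y′)}
             (law Y′) (H.F₁ {S.F₀ Y} {S.F₀ Y′} (S.F₁ {Y} {Y′} f)))
          (Sh._∘_ {H.F₀ (S.F₀ Y)} {S.F₀ (H.F₀ Y)} {S.F₀ (H.F₀ Y′)}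
             (S.F₁ {H.F₀ Y} {H.F₀ Y′} (H.F₁ {Y} {Y′} f)) (law Y))
          (law-natural f)
      ; mult = λ Y → ≈-fromSuccessors (S.F₀ (H.F₀ Y))
          (Sh._∘_ {H.F₀ (S.F₀ (S.F₀ Y))} {H.F₀ (S.F₀ Y)} {S.F₀ (H.F₀ Y)}
             (law Y) (H.F₁ {S.F₀ (S.F₀ Y)} {S.F₀ Y} (μ̂ Y)))
          (Sh._∘_ {H.F₀ (S.F₀ (S.F₀ Y))} {S.F₀ (S.F₀ (H.F₀ Y))} {S.F₀ (H.F₀ Y)} (μ̂ (H.F₀ Y))
             (Sh._∘_ {H.F₀ (S.F₀ (S.F₀ Y))} {S.F₀ (H.F₀ (S.F₀ Y))} {S.F₀ (S.F₀ (H.F₀ Y))}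
                (S.F₁ {H.F₀ (S.F₀ Y)} {S.F₀ (H.F₀ Y)} (law Y)) (law (S.F₀ Y))))
          (law-mult Y)
      ; unit = λ Y → ≈-fromSuccessors (S.F₀ (H.F₀ Y))
          (Sh._∘_ {H.F₀ Y} {H.F₀ (S.F₀ Y)} {S.F₀ (H.F₀ Y)} (law Y) (H.F₁ {Y} {S.F₀ Y} (η̂ Y)))
          (η̂ (H.F₀ Y))
          (law-unit Y) }

  module _ (M : Monad C) where
    open Monad M using (η) renaming (F to T)
    private
      module T = Functor T
      T̄ : RawMonad Sh
      T̄ = OverMonad.barMonad M
      module T̄ = RawFunctor (RawMonad.T T̄)
      module ▸ = RawFunctor laterFunctor

    barDistLaw : (F : Functor C C) → DistLaw C (Functor.raw F) (Monad.rawMonad M) →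
                 DistLaw Sh (Over.barFunctor F) T̄
    barDistLaw F λc = distLaw-fromSuccessors (Over.barFunctor F) T̄
      (λ Y → fromSuccessors _ (T̄.F₀ (F̄.F₀ Y)) (λ n → λc.law _) (λ p → ≈-sym (λc.natural _)))
      (λ f n → λc.natural _)
      (λ Y n → λc.mult _)
      (λ Y n → λc.unit _)
      where
        module λc = DistLaw λc
        module F̄ = RawFunctor (Over.barFunctor F)

    laterDistLaw : Affine C term M → DistLaw Sh laterFunctor T̄
    laterDistLaw aff = distLaw-fromSuccessors laterFunctor T̄ κ
      (λ {_} {Y′} f → λ
        { zero → T-ob₀-subterminal Y′ _ _
        ; (suc n) → identityˡ ○ ≈-sym identityʳ })
      (λ Y → λ
        { zero → T-ob₀-subterminal Y _ _
        ; (suc n) → identityˡ ○ ≈-sym ((≈-refl ⟩∘⟨ (identityʳ ○ T.identity)) ○ identityʳ) })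
      (λ Y → λ
        { zero → T-ob₀-subterminal Y _ _
        ; (suc n) → identityˡ })
      where
        T-ob₀-subterminal : (Y : Sheaf) → Subterminal C (T.F₀ (ob (psh Y) ⟨ 0 ⟩))
        T-ob₀-subterminal Y = affine⇒T-subterminal term M aff (IsSheaf.zero-iso (isSheaf Y))

        κ : (Y : Sheaf) → PMor (psh (▸.F₀ (T̄.F₀ Y))) (psh (T̄.F₀ (▸.F₀ Y)))
        κ Y = fromSuccessors _ (T̄.F₀ (▸.F₀ Y)) κ-successor κ-natural
          where
            κ-successor : ∀ n → ob (psh (▸.F₀ (T̄.F₀ Y))) ⟨ suc n ⟩ ⇒ T.F₀ (ob (psh Y) ⟨ n ⟩)
            κ-successor zero = η _ ∘ IsIso.inv (Iso.isIso (IsSheaf.zero-iso (isSheaf Y)))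
            κ-successor (suc n) = id

            κ-natural : ∀ {m n} (p : m ≤ n) →
              res (psh (T̄.F₀ (▸.F₀ Y))) (fin≤ (s≤s p)) ∘ κ-successor n
                ≈ κ-successor m ∘ res (psh (▸.F₀ (T̄.F₀ Y))) (fin≤ (s≤s p))
            κ-natural {zero} p = T-ob₀-subterminal Y _ _
            κ-natural (s≤s p) = identityʳ ○ ≈-sym identityˡ

    inducedDistLaw : Affine C term M → (F : Functor C C) →
                     DistLaw C (Functor.raw F) (Monad.rawMonad M) →
                     DistLaw Sh (Over.barFunctor F ∘R laterFunctor) T̄
    inducedDistLaw aff F λc =
      distLaw-∘ (barEndofunctor F) laterFunctor T̄
        (λ {X} {Y} {Z} {f} {g} → Functor.homomorphism (barEndofunctor T) {X} {Y} {Z} {f} {g})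
        (barDistLaw F λc) (laterDistLaw aff)

    inducedDistLaw-induces : (aff : Affine C term M) (F : Functor C C)
      (λc : DistLaw C (Functor.raw F) (Monad.rawMonad M)) →
      Induces C term lims M F λc (inducedDistLaw aff F λc)
    inducedDistLaw-induces aff F λc X n =
      ≈-sym ((≈-refl ⟩∘⟨ Functor.identity F) ○ identityʳ)

    inducing-idDistLaw⇒affine :
      (ξ : DistLaw Sh (Over.barFunctor (idFunctor C) ∘R laterFunctor) T̄) →
      Induces C term lims M (idFunctor C) (idDistLaw C M) ξ → Affine C term M
    inducing-idDistLaw⇒affine ξ induces = record
      { inv = !
      ; isoˡ = ⊤-subterminal term _ _
      ; isoʳ = begin
          η ⊤ ∘ !            ≈⟨ ≈-sym (DistLaw.unit ξ (Δ ⊤) ⟨ 1 ⟩) ⟩∘⟨ ≈-refl ⟩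
          (ξ₁ ∘ !) ∘ !       ≈⟨ assoc ○ (≈-refl ⟩∘⟨ ⊤-subterminal term _ _) ⟩
          ξ₁ ∘ !             ≈⟨ ≈-sym (natural (DistLaw.law ξ (Δ ⊤)) (step 1)) ⟩
          T.F₁ ! ∘ ξ₂        ≈⟨ (T.F-resp-≈ (⊤-subterminal term _ _) ○ T.identity) ⟩∘⟨ ≈-sym (induces ⊤ 0) ⟩
          id ∘ id            ≈⟨ identityˡ ⟩
          id                 ∎ }
      where
        ξ₁ : ⊤ ⇒ T.F₀ ⊤
        ξ₁ = comp (DistLaw.law ξ (Δ ⊤)) ⟨ 1 ⟩
        ξ₂ : T.F₀ ⊤ ⇒ T.F₀ ⊤
        ξ₂ = comp (DistLaw.law ξ (Δ ⊤)) ⟨ 2 ⟩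

mainTheorem3 : ∀ {o ℓ e} (C : Category o ℓ e) (term : Terminal C) (lims : ChainLimits C)
                 (M : Monad C) →
                 Affine C term M ⇔ Condition2 C term lims M
mainTheorem3 C term lims M = mk⇔
  (λ aff F λc → inducedDistLaw C term lims M aff F λc , inducedDistLaw-induces C term lims M aff F λc)
  (λ condition2 → let (ξ , induces) = condition2 (idFunctor C) (idDistLaw C M)
                  in inducing-idDistLaw⇒affine C term lims M ξ induces)
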